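{- Let $X$ be a Rado complex, let $U\subseteq V(X)$ be a finite set and let $A\subseteq X_U$ be a subcomplex. Let $Z_{U,A}$ be the set of vertexes $v\in V(X)\setminus U$ satisfying $\mathrm{Lk}_X(v)\cap X_U=A$. Then $Z_{U,A}$ is infinite and the induced subcomplex $X_{Z_{U,A}}$ is also a Rado complex.
   Context: For $U\subseteq V(X)$, $X_U$ denotes the induced subcomplex on $U$; $\mathrm{Lk}_X(v)$ is the subcomplex of simplexes $\sigma$ with $v\notin\sigma$ and $\sigma\cup\{v\}\in X$. A Rado complex is a simplicial complex with a countable vertex set which is $\infty$-ample: it is nonempty and for every finite $U\subseteq V(X)$ and every subcomplex $A\subseteq X_U$ (possibly empty) there exists $v\in V(X)\setminus U$ with $\mathrm{Lk}_X(v)\cap X_U=A$. -}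

module Defs where

open import Data.Nat using (ℕ)
open import Data.List using (List; []; _∷_)
open import Data.List.Membership.Propositional using (_∈_; _∉_)
open import Data.List.Relation.Binary.Subset.Propositional using (_⊆_)
open import Data.List.Relation.Unary.All using (All)
open import Data.Product using (Σ; ∃; _×_; _,_)
open import Relation.Binary.PropositionalEquality using (_≢_)
open import Function.Bundles using (_⇔_)

-- A simplicial complex whose vertex set is a subset of ℕ (every countable
-- set is, up to renaming, a subset of ℕ).  Simplices are nonempty finite
-- sets of vertices, represented by lists (order / repetitions irrelevant,
-- since the family is closed under list-inclusion ⊆ in both directions).
record Complex : Set₁ where
  field
    Vert      : ℕ → Set
    Simp      : List ℕ → Set
    simp-ne   : ∀ {σ} → Simp σ → σ ≢ []
    simp-vert : ∀ {σ} → Simp σ → All Vert σ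
    vert-simp : ∀ {v} → Vert v → Simp (v ∷ [])
    closed    : ∀ {σ τ} → Simp σ → τ ⊆ σ → τ ≢ [] → Simp τ

open Complex public

InInduced : Complex → List ℕ → List ℕ → Set
InInduced X U σ = Simp X σ × σ ⊆ U

InLink : Complex → ℕ → List ℕ → Set
InLink X v σ = v ∉ σ × Simp X (v ∷ σ)

record SubcomplexOfInduced (X : Complex) (U : List ℕ) : Set₁ where
  field
    SimpA    : List ℕ → Set
    A-sub    : ∀ {σ} → SimpA σ → InInduced X U σ
    A-ne     : ∀ {σ} → SimpA σ → σ ≢ []
    A-closed : ∀ {σ τ} → SimpA σ → τ ⊆ σ → τ ≢ [] → SimpA τ

open SubcomplexOfInduced public

LinkCond : (X : Complex) (U : List ℕ) → SubcomplexOfInduced X U → ℕ → Set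
LinkCond X U A v = ∀ σ → (InLink X v σ × InInduced X U σ) ⇔ SimpA A σ

InZ : (X : Complex) (U : List ℕ) → SubcomplexOfInduced X U → ℕ → Set
InZ X U A v = Vert X v × v ∉ U × LinkCond X U A v

-- ∞-ample (Rado): nonempty, and every finite U ⊆ V(X) and subcomplex
-- A ⊆ X_U admit v ∈ V(X) ∖ U with Lk_X(v) ∩ X_U = A.
IsRado : Complex → Set₁
IsRado X =
  (∃ λ v → Vert X v) ×
  ((U : List ℕ) → All (Vert X) U → (A : SubcomplexOfInduced X U) →
     ∃ λ v → InZ X U A v)

Infinite : (ℕ → Set) → Set
Infinite P = (L : List ℕ) → ∃ λ v → P v × v ∉ L

induced : (X : Complex) (Z : ℕ → Set) → (∀ {v} → Z v → Vert X v) → Complex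
induced X Z zv = record
  { Vert      = Z
  ; Simp      = λ σ → Simp X σ × All Z σ
  ; simp-ne   = λ { (s , _) → simp-ne X s }
  ; simp-vert = λ { (_ , a) → a }
  ; vert-simp = λ z → vert-simp X (zv z) , (z All.∷ All.[])
  ; closed    = λ { (s , a) τ⊆σ ne → closed X s τ⊆σ ne , All.tabulate (λ x∈τ → All.lookup a (τ⊆σ x∈τ)) }
  }
  where import Data.List.Relation.Unary.All as All

Z-vert : (X : Complex) (U : List ℕ) (A : SubcomplexOfInduced X U) →
         ∀ {v} → InZ X U A v → Vert X v
Z-vert X U A (p , _) = p

{-# OPTIONS --safe #-}
-- Apply ampleness of X to U ∪ U' and the subcomplex A ∪ B, where U' ⊆ Z_{U,A} and
-- B ⊆ (X_Z)_{U'}.  Since U' is disjoint from U, every simplex of A ∪ B inside U lies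
-- in A and every one inside U' lies in B, so the vertex produced has link A on U
-- (it lies in Z_{U,A}) and link B on U'.  Thus X_Z is ample; infinitude of Z follows
-- because every ample complex has infinitely many vertices.
module Submission where

open import Defs
open import Data.List using (List; []; _∷_; _++_)
open import Data.List.Relation.Unary.All using (All; _∷_)
import Data.List.Relation.Unary.All as All
open import Data.List.Relation.Unary.All.Properties using (++⁺)
open import Data.List.Relation.Unary.Any using (here; there)
open import Data.List.Membership.Propositional using (_∉_)
open import Data.List.Membership.Propositional.Properties using (∈-++⁺ˡ; ∈-++⁺ʳ)
open import Data.List.Relation.Binary.Subset.Propositional using (_⊆_)
open import Data.List.Relation.Binary.Subset.Propositional.Properties
  using (⊆-trans; xs⊆xs++ys; xs⊆ys++xs)
open import Data.List.Relation.Binary.Disjoint.Propositional using (Disjoint)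
open import Data.Nat using (ℕ; _≟_)
open import Data.Product using (_×_; _,_; ∃; proj₁; proj₂)
open import Data.Sum using (_⊎_; inj₁; inj₂)
open import Data.Empty using (⊥; ⊥-elim)
open import Relation.Nullary using (yes; no)
open import Relation.Binary.PropositionalEquality using (refl; _≢_)
open import Function.Bundles using (mk⇔; Equivalence)

open Equivalence

avoiding⇒Infinite : {P : ℕ → Set} →
  ((W : List ℕ) → All P W → ∃ λ v → P v × v ∉ W) → Infinite P
avoiding⇒Infinite {P} avoid L = let v , pv , v∉L , _ = go L [] All.[] in v , pv , v∉L
  where
  go : (L W : List ℕ) → All P W → ∃ λ v → P v × v ∉ L × v ∉ W
  go [] W pW = let v , pv , v∉W = avoid W pW in v , pv , (λ ()) , v∉W
  -- A witness that hits w satisfies P, so it can be moved into the avoided list.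
  go (w ∷ L) W pW with go L W pW
  ... | v , pv , v∉L , v∉W with v ≟ w
  ...   | no v≢w = v , pv , (λ { (here v≡w) → v≢w v≡w ; (there v∈L) → v∉L v∈L }) , v∉W
  ...   | yes refl with go L (v ∷ W) (pv ∷ pW)
  ...     | v′ , pv′ , v′∉L , v′∉vW =
    v′ , pv′ , (λ { (here v′≡v) → v′∉vW (here v′≡v) ; (there v′∈L) → v′∉L v′∈L })
       , (λ v′∈W → v′∉vW (there v′∈W))

module _ (X : Complex) where

  ∅ˢ : (U : List ℕ) → SubcomplexOfInduced X U
  ∅ˢ U = record
    { SimpA    = λ _ → ⊥
    ; A-sub    = λ ()
    ; A-ne     = λ ()
    ; A-closed = λ ()
    }

  _∪ˢ_ : {U W : List ℕ} →
    SubcomplexOfInduced X U → SubcomplexOfInduced X W → SubcomplexOfInduced X (U ++ W)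
  _∪ˢ_ {U} {W} A B = record
    { SimpA    = λ σ → SimpA A σ ⊎ SimpA B σ
    ; A-sub    = λ { (inj₁ a) → proj₁ (A-sub A a) , ⊆-trans (proj₂ (A-sub A a)) (xs⊆xs++ys U W)
                   ; (inj₂ b) → proj₁ (A-sub B b) , ⊆-trans (proj₂ (A-sub B b)) (xs⊆ys++xs W U) }
    ; A-ne     = λ { (inj₁ a) → A-ne A a ; (inj₂ b) → A-ne B b }
    ; A-closed = λ { (inj₁ a) τ⊆σ ne → inj₁ (A-closed A a τ⊆σ ne)
                   ; (inj₂ b) τ⊆σ ne → inj₂ (A-closed B b τ⊆σ ne) }
    }

  Rado⇒Infinite : IsRado X → Infinite (Vert X)
  Rado⇒Infinite (_ , ample) = avoiding⇒Infinite λ W vW →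
    let v , vv , v∉W , _ = ample W vW (∅ˢ W) in v , vv , v∉W

  LinkCond-restrict : {U U′ : List ℕ} {A : SubcomplexOfInduced X U}
    {C : SubcomplexOfInduced X U′} {v : ℕ} → U ⊆ U′ →
    (∀ {σ} → σ ⊆ U → SimpA C σ → SimpA A σ) → (∀ {σ} → SimpA A σ → SimpA C σ) →
    LinkCond X U′ C v → LinkCond X U A v
  LinkCond-restrict {A = A} U⊆U′ trace embed lc σ = mk⇔
    (λ { (lk , s , σ⊆U) → trace σ⊆U (to (lc σ) (lk , s , ⊆-trans σ⊆U U⊆U′)) })
    (λ a → proj₁ (from (lc σ) (embed a)) , A-sub A a)

  Disjoint⇒¬common-nonempty : {U W σ : List ℕ} → Disjoint U W → σ ≢ [] → σ ⊆ U → σ ⊆ W → ⊥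
  Disjoint⇒¬common-nonempty {σ = []}    _     ne _   _   = ne refl
  Disjoint⇒¬common-nonempty {σ = x ∷ σ} U∩W=∅ _  σ⊆U σ⊆W = U∩W=∅ (σ⊆U (here refl) , σ⊆W (here refl))

  module _ {U W : List ℕ} (U∩W=∅ : Disjoint U W)
           (A : SubcomplexOfInduced X U) (B : SubcomplexOfInduced X W) {v : ℕ} where

    ∪ˢ-LinkCondˡ : LinkCond X (U ++ W) (A ∪ˢ B) v → LinkCond X U A v
    ∪ˢ-LinkCondˡ = LinkCond-restrict {A = A} {C = A ∪ˢ B} (xs⊆xs++ys U W) trace inj₁
      where
      trace : ∀ {σ} → σ ⊆ U → SimpA A σ ⊎ SimpA B σ → SimpA A σ
      trace _   (inj₁ a) = a
      trace σ⊆U (inj₂ b) = ⊥-elim (Disjoint⇒¬common-nonempty U∩W=∅ (A-ne B b) σ⊆U (proj₂ (A-sub B b)))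

    ∪ˢ-LinkCondʳ : LinkCond X (U ++ W) (A ∪ˢ B) v → LinkCond X W B v
    ∪ˢ-LinkCondʳ = LinkCond-restrict {A = B} {C = A ∪ˢ B} (xs⊆ys++xs W U) trace inj₂
      where
      trace : ∀ {σ} → σ ⊆ W → SimpA A σ ⊎ SimpA B σ → SimpA B σ
      trace σ⊆W (inj₁ a) = ⊥-elim (Disjoint⇒¬common-nonempty U∩W=∅ (A-ne A a) (proj₂ (A-sub A a)) σ⊆W)
      trace _   (inj₂ b) = b

  module _ {Z : ℕ → Set} (Z⊆V : ∀ {v} → Z v → Vert X v) where

    ambientˢ : {U : List ℕ} → SubcomplexOfInduced (induced X Z Z⊆V) U → SubcomplexOfInduced X U
    ambientˢ B = record
      { SimpA    = SimpA B
      ; A-sub    = λ b → proj₁ (proj₁ (A-sub B b)) , proj₂ (A-sub B b)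
      ; A-ne     = A-ne B
      ; A-closed = A-closed B
      }

    LinkCond-induced : {U : List ℕ} (B : SubcomplexOfInduced (induced X Z Z⊆V) U) {v : ℕ} →
      Z v → LinkCond X U (ambientˢ B) v → LinkCond (induced X Z Z⊆V) U B v
    LinkCond-induced B zv lc σ = mk⇔
      (λ { ((v∉σ , s , _) , (s′ , _) , σ⊆U) → to (lc σ) ((v∉σ , s) , s′ , σ⊆U) })
      (λ b → let v∉σ , s = proj₁ (from (lc σ) b)
             in (v∉σ , s , zv ∷ proj₂ (proj₁ (A-sub B b))) , A-sub B b)

  module _ (rado : IsRado X) (U : List ℕ) (vU : All (Vert X) U) (A : SubcomplexOfInduced X U) where

    Rado⇒induced-Z-Rado : IsRado (induced X (InZ X U A) (Z-vert X U A))
    Rado⇒induced-Z-Rado = nonempty , ample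
      where
      nonempty : ∃ λ v → InZ X U A v
      nonempty = proj₂ rado U vU A

      ample : (U′ : List ℕ) → All (InZ X U A) U′ →
        (B : SubcomplexOfInduced (induced X (InZ X U A) (Z-vert X U A)) U′) →
        ∃ λ v → InZ (induced X (InZ X U A) (Z-vert X U A)) U′ B v
      ample U′ zU′ B =
        let U∩U′=∅ : Disjoint U U′
            U∩U′=∅ (x∈U , x∈U′) = proj₁ (proj₂ (All.lookup zU′ x∈U′)) x∈U
            B̂ : SubcomplexOfInduced X U′
            B̂ = ambientˢ (Z-vert X U A) B
            v , vv , v∉UU′ , lc = proj₂ rado (U ++ U′) (++⁺ vU (All.map (Z-vert X U A) zU′)) (A ∪ˢ B̂)
            zv : InZ X U A v
            zv = vv , (λ v∈U → v∉UU′ (∈-++⁺ˡ v∈U)) , ∪ˢ-LinkCondˡ U∩U′=∅ A B̂ lc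
        in v , zv , (λ v∈U′ → v∉UU′ (∈-++⁺ʳ U v∈U′))
             , LinkCond-induced (Z-vert X U A) B zv (∪ˢ-LinkCondʳ U∩U′=∅ A B̂ lc)

lemma10p1 : (X : Complex) → IsRado X →
    (U : List ℕ) → All (Vert X) U → (A : SubcomplexOfInduced X U) →
    Infinite (InZ X U A) × IsRado (induced X (InZ X U A) (Z-vert X U A))
lemma10p1 X rado U vU A = Rado⇒Infinite Y Y-rado , Y-rado
  where
  Y = induced X (InZ X U A) (Z-vert X U A)
  Y-rado = Rado⇒induced-Z-Rado X rado U vU A
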